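{- Let $G$ be a minimal counterexample and $B=\overline{G}$. Then $B$ has no reduction.
   Context: A minimal counterexample is a simple graph $G$ of order $n\ge 5$ with at least $\binom{n}{2}-n+5$ edges that has no orientation of diameter two, chosen of minimum order among all such graphs and, subject to that, of minimum size. Write $R=G$ and $B=\overline{G}$ (the complement, on the same vertex set $V$). For $W\subseteq V$, an orientation $O_W$ of $R[W]$ is good if there is a partition of $W$ into two sets $U_1,V_1$ with $d_{O_W}(x,y)\le 2$ (directed distance) whenever $x,y$ are both in $U_1$ or both in $V_1$; it is non-trivial good if moreover every vertex of $U_1$ has an in-neighbor and an out-neighbor in $V_1$ and vice versa. The excess of a graph $H$ is ${\rm ex}(H)=m(H)-n(H)$ (size minus order). A set $W\subseteq V$ such that $B[W]$ is the union of one or more components of $B$ is a reduction if $R[W]$ has a non-trivial good orientation and ${\rm ex}(B[W])\ge -1$. -}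

module Defs where

open import Data.Nat using (ℕ; _+_; _≤_; _<_; _<ᵇ_)
open import Data.Nat.Combinatorics using (_C_)
open import Data.Integer using (ℤ; +_; -_; _-_) renaming (_≤_ to _≤ℤ_)
open import Data.Bool using (Bool; true; false; not; _∧_; if_then_else_)
open import Data.Bool.Properties using (∧-zeroʳ)
open import Data.Fin using (Fin; toℕ; _≟_)
open import Data.List using (List; map; concatMap; allFin)
open import Data.Nat.ListAction using (sum)
open import Data.Product using (Σ; ∃; _×_; _,_)
open import Data.Sum using (_⊎_)
open import Data.Empty using (⊥-elim)
open import Relation.Nullary using (¬_; ⌊_⌋; yes; no)
open import Relation.Binary.PropositionalEquality as Eq using (_≡_; _≢_; refl; cong)

record Graph (n : ℕ) : Set where
  field
    adj    : Fin n → Fin n → Bool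
    sym    : ∀ i j → adj i j ≡ adj j i
    irrefl : ∀ i → adj i i ≡ false
open Graph public

private
  ≟-sym : ∀ {n} (i j : Fin n) → ⌊ i ≟ j ⌋ ≡ ⌊ j ≟ i ⌋
  ≟-sym i j with i ≟ j | j ≟ i
  ... | yes _ | yes _ = refl
  ... | no _  | no _  = refl
  ... | yes p | no q  = ⊥-elim (q (Eq.sym p))
  ... | no p  | yes q = ⊥-elim (p (Eq.sym q))

  ≟-refl : ∀ {n} (i : Fin n) → ⌊ i ≟ i ⌋ ≡ true
  ≟-refl i with i ≟ i
  ... | yes _ = refl
  ... | no p  = ⊥-elim (p refl)

complement : ∀ {n} → Graph n → Graph n
complement {n} G = record { adj = a ; sym = s ; irrefl = ir }
  where
  a : Fin n → Fin n → Bool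
  a i j = not (adj G i j) ∧ not ⌊ i ≟ j ⌋
  s : ∀ i j → a i j ≡ a j i
  s i j rewrite sym G i j | ≟-sym i j = refl
  ir : ∀ i → a i i ≡ false
  ir i rewrite ≟-refl i = ∧-zeroʳ (not (adj G i i))

-- number of unordered pairs {i,j} (i ≠ j) with A i j = true,
-- counted as ordered pairs with toℕ i < toℕ j.
pairCount : ∀ {n} → (Fin n → Fin n → Bool) → ℕ
pairCount {n} A =
  sum (concatMap (λ i → map (λ j → if A i j ∧ (toℕ i <ᵇ toℕ j) then 1 else 0)
                            (allFin n))
                 (allFin n))

size : ∀ {n} → Graph n → ℕ
size G = pairCount (adj G)

Subset : ℕ → Set
Subset n = Fin n → Bool

card : ∀ {n} → Subset n → ℕ
card {n} W = sum (map (λ i → if W i then 1 else 0) (allFin n))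

inducedSize : ∀ {n} → Graph n → Subset n → ℕ
inducedSize G W = pairCount (λ i j → W i ∧ W j ∧ adj G i j)

excessInduced : ∀ {n} → Graph n → Subset n → ℤ
excessInduced G W = + inducedSize G W - + card W

record OrientationOn {n} (R : Graph n) (W : Subset n) : Set where
  field
    arc        : Fin n → Fin n → Bool
    arc-inside : ∀ i j → arc i j ≡ true → (W i ≡ true × W j ≡ true × adj R i j ≡ true)
    arc-total  : ∀ i j → W i ≡ true → W j ≡ true → adj R i j ≡ true →
                 arc i j ≡ true ⊎ arc j i ≡ true
    arc-antisym : ∀ i j → arc i j ≡ true → arc j i ≡ false
open OrientationOn public

dist≤2 : ∀ {n} → (Fin n → Fin n → Bool) → Fin n → Fin n → Set
dist≤2 {n} D x y = x ≡ y ⊎ D x y ≡ true ⊎ Σ (Fin n) (λ z → D x z ≡ true × D z y ≡ true)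

allV : ∀ {n} → Subset n
allV _ = true

HasDiam2Orientation : ∀ {n} → Graph n → Set
HasDiam2Orientation {n} G =
  Σ (OrientationOn G allV) λ O → ∀ (x y : Fin n) → dist≤2 (arc O) x y

-- O is a good orientation of R[W], witnessed by the partition of W into
-- U₁ = {x ∈ W | side x = true} and V₁ = {x ∈ W | side x = false}.
IsGoodVia : ∀ {n} {R : Graph n} {W : Subset n} → OrientationOn R W → (Fin n → Bool) → Set
IsGoodVia {n} {W = W} O side =
  ∀ (x y : Fin n) → W x ≡ true → W y ≡ true → side x ≡ side y → dist≤2 (arc O) x y

IsNonTrivialVia : ∀ {n} {R : Graph n} {W : Subset n} → OrientationOn R W → (Fin n → Bool) → Set
IsNonTrivialVia {n} {W = W} O side =
  ∀ (x : Fin n) → W x ≡ true →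
    Σ (Fin n) (λ y → W y ≡ true × side y ≢ side x × arc O y x ≡ true) ×
    Σ (Fin n) (λ y → W y ≡ true × side y ≢ side x × arc O x y ≡ true)

HasNonTrivialGoodOrientation : ∀ {n} → Graph n → Subset n → Set
HasNonTrivialGoodOrientation R W =
  Σ (OrientationOn R W) λ O → Σ (Fin _ → Bool) λ side →
    IsGoodVia O side × IsNonTrivialVia O side

-- n ≥ 5, m ≥ C(n,2) - n + 5 (written without truncated subtraction),
-- and no orientation of diameter two.
IsCounterexample : ∀ {n} → Graph n → Set
IsCounterexample {n} G =
  5 ≤ n × (n C 2) + 5 ≤ size G + n × ¬ HasDiam2Orientation G

IsMinimalCounterexample : ∀ {n} → Graph n → Set
IsMinimalCounterexample {n} G =
  IsCounterexample G ×
  (∀ (n' : ℕ) (G' : Graph n') → IsCounterexample G' →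
     n < n' ⊎ (n ≡ n' × size G ≤ size G'))

-- B[W] is the union of one or more components of B:
-- W is nonempty and closed under B-adjacency.
IsUnionOfComponents : ∀ {n} → Graph n → Subset n → Set
IsUnionOfComponents {n} B W =
  Σ (Fin n) (λ x → W x ≡ true) ×
  (∀ (x y : Fin n) → W x ≡ true → adj B x y ≡ true → W y ≡ true)

IsReduction : ∀ {n} → Graph n → Subset n → Set
IsReduction G W =
  IsUnionOfComponents (complement G) W ×
  HasNonTrivialGoodOrientation G W ×
  - (+ 1) ≤ℤ excessInduced (complement G) W

-- Replace W by two nonadjacent new vertices, standing for the parts U₁ and V₁ of a
-- non-trivial good orientation of G[W], and join them to every vertex outside W. Since B[W] is
-- a union of components of B, every vertex of W is already joined in G to every vertex outside
-- W, so the complement of the new graph is B[V∖W] plus one edge; ex(B[W]) ≥ −1 then keeps the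
-- edge bound, and |W| ≥ 3 makes the new graph strictly smaller. A diameter-two orientation of
-- it lifts to G: orient G[W] by the good orientation and every other edge like its image. Two
-- vertices of W on different sides are joined through the middle vertex of a path of length
-- two between the new vertices, and a path through a new vertex is rerouted through any vertex
-- of the corresponding part. So the new graph is a smaller counterexample.

module Submission where

open import Defs hiding (sym)
open import Data.Nat using (ℕ; zero; suc; _+_; _≤_; _<_; _<ᵇ_; z≤n; s≤s)
open import Data.Nat.Properties hiding (_≟_; suc-injective)
open import Data.Nat.Combinatorics using (_C_; nC1≡n; nCk+nC[k+1]≡[n+1]C[k+1])
import Data.Nat.ListAction as List
open import Data.Nat.ListAction.Properties using (sum-++)
open import Data.Bool using (Bool; true; false; not; _∧_; if_then_else_)
open import Data.Bool.Properties using (∧-zeroʳ; ∧-comm; ¬-not; not-involutive) renaming (_≟_ to _≟ᵇ_)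
open import Data.Fin using (Fin; zero; suc; toℕ; _≟_)
open import Data.List using (List; []; _∷_; map; concatMap; allFin; tabulate)
open import Data.List.Properties using (map-tabulate)
open import Data.Product using (Σ; _×_; _,_; proj₂)
open import Data.Sum using (_⊎_; inj₁; inj₂)
open import Data.Empty using (⊥-elim)
open import Data.Integer using (-1ℤ; _⊖_; -≤-) renaming (_≤_ to _≤ℤ_)
open import Data.Integer.Properties using (m-n≡m⊖n; [1+m]⊖[1+n]≡m⊖n)
open import Data.Maybe as Maybe using (Maybe; just; nothing)
open import Data.Maybe.Properties using (just-injective)
open import Relation.Nullary using (¬_; ⌊_⌋; yes; no)
open import Relation.Binary.PropositionalEquality
  using (_≡_; _≢_; refl; sym; trans; cong; cong₂; subst; module ≡-Reasoning)
open import Data.Fin.Properties using (suc-injective)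
open import Function using (_∘_)
open import Function.Definitions using (Injective)
open import Algebra.Properties.CommutativeMonoid.Sum +-0-commutativeMonoid
  using (sum; sum-syntax; sum-cong-≗; ∑-distrib-+; sum-replicate-zero)

indicator : Bool → ℕ
indicator b = if b then 1 else 0

∑-mono-≤ : ∀ n {f g : Fin n → ℕ} → (∀ i → f i ≤ g i) → sum f ≤ sum g
∑-mono-≤ zero    le = z≤n
∑-mono-≤ (suc n) le = +-mono-≤ (le zero) (∑-mono-≤ n (le ∘ suc))

∑-const-1 : ∀ n → ∑[ i < n ] 1 ≡ n
∑-const-1 zero    = refl
∑-const-1 (suc n) = cong suc (∑-const-1 n)

∑₂-cong : ∀ n {f g : Fin n → Fin n → ℕ} → (∀ i j → f i j ≡ g i j) →
  ∑[ i < n ] ∑[ j < n ] f i j ≡ ∑[ i < n ] ∑[ j < n ] g i j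
∑₂-cong n eq = sum-cong-≗ (λ i → sum-cong-≗ (eq i))

∑₂-distrib-+ : ∀ n (f g : Fin n → Fin n → ℕ) →
  ∑[ i < n ] ∑[ j < n ] (f i j + g i j) ≡ ∑[ i < n ] ∑[ j < n ] f i j + ∑[ i < n ] ∑[ j < n ] g i j
∑₂-distrib-+ n f g =
  trans (sum-cong-≗ (λ i → ∑-distrib-+ (f i) (g i))) (∑-distrib-+ (λ i → ∑[ j < n ] f i j) (λ i → ∑[ j < n ] g i j))

listSum-tabulate : ∀ n (f : Fin n → ℕ) → List.sum (tabulate f) ≡ sum f
listSum-tabulate zero    f = refl
listSum-tabulate (suc n) f = cong (f zero +_) (listSum-tabulate n (f ∘ suc))

listSum-allFin : ∀ n (f : Fin n → ℕ) → List.sum (map f (allFin n)) ≡ sum f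
listSum-allFin n f = trans (cong List.sum (map-tabulate (λ i → i) f)) (listSum-tabulate n f)

listSum-concatMap : ∀ {A : Set} (h : A → List ℕ) (xs : List A) →
  List.sum (concatMap h xs) ≡ List.sum (map (List.sum ∘ h) xs)
listSum-concatMap h []       = refl
listSum-concatMap h (x ∷ xs) = trans (sum-++ (h x) (concatMap h xs)) (cong (List.sum (h x) +_) (listSum-concatMap h xs))

card≡∑ : ∀ {n} (W : Subset n) → card W ≡ ∑[ i < n ] indicator (W i)
card≡∑ {n} W = listSum-allFin n _

pairTerm : ∀ {n} → (Fin n → Fin n → Bool) → Fin n → Fin n → ℕ
pairTerm A i j = indicator (A i j ∧ (toℕ i <ᵇ toℕ j))

pairCount≡∑ : ∀ {n} (A : Fin n → Fin n → Bool) → pairCount A ≡ ∑[ i < n ] ∑[ j < n ] pairTerm A i j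
pairCount≡∑ {n} A = trans (listSum-concatMap _ (allFin n))
  (trans (listSum-allFin n _) (sum-cong-≗ (λ i → listSum-allFin n (pairTerm A i))))

<ᵇ-irrefl : ∀ m → (m <ᵇ m) ≡ false
<ᵇ-irrefl zero    = refl
<ᵇ-irrefl (suc m) = <ᵇ-irrefl m

∑-<ᵇ≡C2 : ∀ n → ∑[ i < n ] ∑[ j < n ] indicator (toℕ i <ᵇ toℕ j) ≡ n C 2
∑-<ᵇ≡C2 zero    = refl
∑-<ᵇ≡C2 (suc n) = begin
  -- row 0 contributes n and column 0 nothing
  ∑[ j < n ] 1 + ∑[ i < n ] ∑[ j < n ] indicator (toℕ i <ᵇ toℕ j) ≡⟨ cong₂ _+_ (∑-const-1 n) (∑-<ᵇ≡C2 n) ⟩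
  n + n C 2                                                       ≡⟨ cong (_+ n C 2) (nC1≡n n) ⟨
  n C 1 + n C 2                                                   ≡⟨ nCk+nC[k+1]≡[n+1]C[k+1] n 1 ⟩
  suc n C 2                                                       ∎
  where open ≡-Reasoning

pairTerm-complement : ∀ {n} (G : Graph n) i j →
  pairTerm (adj G) i j + pairTerm (adj (complement G)) i j ≡ indicator (toℕ i <ᵇ toℕ j)
pairTerm-complement G i j with toℕ i <ᵇ toℕ j in i<j | i ≟ j
... | false | i≟j rewrite ∧-zeroʳ (adj G i j) | ∧-zeroʳ (not (adj G i j) ∧ not ⌊ i≟j ⌋) = refl
... | true | yes refl rewrite <ᵇ-irrefl (toℕ i) with i<j
...   | ()
pairTerm-complement G i j | true | no _ with adj G i j
... | true  = refl
... | false = refl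

size+size-complement : ∀ {n} (G : Graph n) → size G + size (complement G) ≡ n C 2
size+size-complement {n} G = begin
  size G + size (complement G)
    ≡⟨ cong₂ _+_ (pairCount≡∑ (adj G)) (pairCount≡∑ (adj (complement G))) ⟩
  ∑[ i < n ] ∑[ j < n ] pairTerm (adj G) i j + ∑[ i < n ] ∑[ j < n ] pairTerm (adj (complement G)) i j
    ≡⟨ ∑₂-distrib-+ n _ _ ⟨
  ∑[ i < n ] ∑[ j < n ] (pairTerm (adj G) i j + pairTerm (adj (complement G)) i j)
    ≡⟨ ∑₂-cong n (pairTerm-complement G) ⟩
  ∑[ i < n ] ∑[ j < n ] indicator (toℕ i <ᵇ toℕ j)
    ≡⟨ ∑-<ᵇ≡C2 n ⟩
  n C 2 ∎
  where open ≡-Reasoning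

∁ : ∀ {n} → Subset n → Subset n
∁ W i = not (W i)

count : ∀ {n} → Subset n → ℕ
count {n} S = ∑[ i < n ] indicator (S i)

card+count∁≡n : ∀ {n} (W : Subset n) → card W + count (∁ W) ≡ n
card+count∁≡n {n} W = begin
  card W + count (∁ W)                                  ≡⟨ cong (_+ count (∁ W)) (card≡∑ W) ⟩
  count W + count (∁ W)                                 ≡⟨ ∑-distrib-+ (indicator ∘ W) (indicator ∘ ∁ W) ⟨
  ∑[ i < n ] (indicator (W i) + indicator (not (W i))) ≡⟨ sum-cong-≗ one ⟩
  ∑[ i < n ] 1                                          ≡⟨ ∑-const-1 n ⟩
  n                                                     ∎
  where
  open ≡-Reasoning
  one : ∀ i → indicator (W i) + indicator (not (W i)) ≡ 1
  one i with W i
  ... | true  = refl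
  ... | false = refl

⌊≟⌋-injective : ∀ {m n} (f : Fin m → Fin n) → Injective _≡_ _≡_ f →
  ∀ a b → ⌊ f a ≟ f b ⌋ ≡ ⌊ a ≟ b ⌋
⌊≟⌋-injective f inj a b with f a ≟ f b | a ≟ b
... | yes _  | yes _    = refl
... | no _   | no _     = refl
... | yes fa≡fb | no a≢b = ⊥-elim (a≢b (inj fa≡fb))
... | no fa≢fb | yes refl = ⊥-elim (fa≢fb refl)

indicator≟ : ∀ {n} → Fin n → Fin n → ℕ
indicator≟ a i = indicator ⌊ i ≟ a ⌋

∑-indicator≟ : ∀ n (a : Fin n) → ∑[ i < n ] indicator≟ a i ≡ 1
∑-indicator≟ (suc n) zero    = cong suc (sum-replicate-zero n)
∑-indicator≟ (suc n) (suc a) =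
  trans (sum-cong-≗ (λ i → cong indicator (⌊≟⌋-injective suc suc-injective i a))) (∑-indicator≟ n a)

three-members⇒3≤card : ∀ {n} (W : Subset n) a b c → W a ≡ true → W b ≡ true → W c ≡ true →
  a ≢ b → a ≢ c → b ≢ c → 3 ≤ card W
three-members⇒3≤card {n} W a b c wa wb wc a≢b a≢c b≢c = begin
  3 ≡⟨ cong₂ _+_ (∑-indicator≟ n a) (cong₂ _+_ (∑-indicator≟ n b) (∑-indicator≟ n c)) ⟨
  sum (indicator≟ a) + (sum (indicator≟ b) + sum (indicator≟ c))
    ≡⟨ cong (sum (indicator≟ a) +_) (∑-distrib-+ (indicator≟ b) (indicator≟ c)) ⟨
  sum (indicator≟ a) + ∑[ i < n ] (indicator≟ b i + indicator≟ c i)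
    ≡⟨ ∑-distrib-+ (indicator≟ a) (λ i → indicator≟ b i + indicator≟ c i) ⟨
  ∑[ i < n ] (indicator≟ a i + (indicator≟ b i + indicator≟ c i)) ≤⟨ ∑-mono-≤ n pointwise ⟩
  ∑[ i < n ] indicator (W i) ≡⟨ card≡∑ W ⟨
  card W ∎
  where
  open ≤-Reasoning
  pointwise : ∀ i → indicator≟ a i + (indicator≟ b i + indicator≟ c i) ≤ indicator (W i)
  pointwise i with i ≟ a | i ≟ b | i ≟ c
  ... | yes refl | yes p    | _        = ⊥-elim (a≢b p)
  ... | yes refl | no _     | yes p    = ⊥-elim (a≢c p)
  ... | yes refl | no _     | no _     rewrite wa = s≤s z≤n
  ... | no _     | yes refl | yes p    = ⊥-elim (b≢c p)
  ... | no _     | yes refl | no _     rewrite wb = s≤s z≤n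
  ... | no _     | no _     | yes refl rewrite wc = s≤s z≤n
  ... | no _     | no _     | no _     = z≤n

Closed : ∀ {n} → Graph n → Subset n → Set
Closed {n} H W = ∀ (x y : Fin n) → W x ≡ true → adj H x y ≡ true → W y ≡ true

inducedSize+inducedSize∁ : ∀ {n} (H : Graph n) (W : Subset n) → Closed H W →
  inducedSize H W + inducedSize H (∁ W) ≡ size H
inducedSize+inducedSize∁ {n} H W closed = begin
  inducedSize H W + inducedSize H (∁ W)
    ≡⟨ cong₂ _+_ (pairCount≡∑ inside) (pairCount≡∑ outside) ⟩
  ∑[ i < n ] ∑[ j < n ] pairTerm inside i j + ∑[ i < n ] ∑[ j < n ] pairTerm outside i j
    ≡⟨ ∑₂-distrib-+ n (pairTerm inside) (pairTerm outside) ⟨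
  ∑[ i < n ] ∑[ j < n ] (pairTerm inside i j + pairTerm outside i j)
    ≡⟨ ∑₂-cong n split ⟩
  ∑[ i < n ] ∑[ j < n ] pairTerm (adj H) i j
    ≡⟨ pairCount≡∑ (adj H) ⟨
  size H ∎
  where
  open ≡-Reasoning
  inside outside : Fin n → Fin n → Bool
  inside  i j = W i ∧ W j ∧ adj H i j
  outside i j = ∁ W i ∧ ∁ W j ∧ adj H i j
  split : ∀ i j → pairTerm inside i j + pairTerm outside i j ≡ pairTerm (adj H) i j
  split i j with W i in wi | W j in wj | adj H i j in hij
  ... | true  | true  | true  = +-identityʳ _
  ... | true  | true  | false = refl
  ... | false | false | true  = refl
  ... | false | false | false = refl
  ... | true  | false | false = refl
  ... | false | true  | false = refl
  ... | true  | false | true with trans (sym (closed i j wi hij)) wj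
  ...   | ()
  split i j | false | true | true with trans (sym (closed j i wj (trans (Graph.sym H j i) hij))) wi
  ...   | ()

adj-complement : ∀ {n} (G : Graph n) x y → adj G x y ≡ false → x ≢ y → adj (complement G) x y ≡ true
adj-complement G x y gxy x≢y rewrite gxy with x ≟ y
... | yes x≡y = ⊥-elim (x≢y x≡y)
... | no _    = refl

Closed-complement⇒adj : ∀ {n} (G : Graph n) (W : Subset n) → Closed (complement G) W →
  ∀ x y → W x ≡ true → W y ≡ false → adj G x y ≡ true
Closed-complement⇒adj G W closed x y wx wy with adj G x y in gxy
... | true  = refl
... | false with trans (sym (closed x y wx (adj-complement G x y gxy x≢y))) wy
  where
  x≢y : x ≢ y
  x≢y refl with trans (sym wx) wy
  ... | ()
...   | ()

-1≤m⊖n⇒n≤1+m : ∀ m n → -1ℤ ≤ℤ m ⊖ n → n ≤ suc m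
-1≤m⊖n⇒n≤1+m m       zero    _         = z≤n
-1≤m⊖n⇒n≤1+m zero    (suc n) (-≤- n≤0) = s≤s n≤0
-1≤m⊖n⇒n≤1+m (suc m) (suc n) le rewrite [1+m]⊖[1+n]≡m⊖n m n = s≤s (-1≤m⊖n⇒n≤1+m m n le)

excess≥-1⇒card≤size+1 : ∀ {n} (H : Graph n) (W : Subset n) →
  -1ℤ ≤ℤ excessInduced H W → card W ≤ suc (inducedSize H W)
excess≥-1⇒card≤size+1 H W le rewrite m-n≡m⊖n (inducedSize H W) (card W) = -1≤m⊖n⇒n≤1+m _ _ le

edgeBound⇒complementBound : ∀ {n} (G : Graph n) → (n C 2) + 5 ≤ size G + n → size (complement G) + 5 ≤ n
edgeBound⇒complementBound {n} G le = +-cancelˡ-≤ (size G) _ _ (begin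
  size G + (size (complement G) + 5) ≡⟨ +-assoc (size G) _ 5 ⟨
  size G + size (complement G) + 5   ≡⟨ cong (_+ 5) (size+size-complement G) ⟩
  n C 2 + 5                          ≤⟨ le ⟩
  size G + n                         ∎)
  where open ≤-Reasoning

complementBound⇒edgeBound : ∀ {n} (G : Graph n) → size (complement G) + 5 ≤ n → (n C 2) + 5 ≤ size G + n
complementBound⇒edgeBound {n} G le = begin
  n C 2 + 5                          ≡⟨ cong (_+ 5) (size+size-complement G) ⟨
  size G + size (complement G) + 5   ≡⟨ +-assoc (size G) _ 5 ⟩
  size G + (size (complement G) + 5) ≤⟨ +-monoʳ-≤ (size G) le ⟩
  size G + n                         ∎
  where open ≤-Reasoning

-- Enumerating a subset

enumerate : ∀ {n} (S : Subset n) → Fin (count S) → Fin n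
enumerate {suc n} S = cons (S zero) (enumerate (S ∘ suc))
  where
  cons : ∀ {c} (b : Bool) → (Fin c → Fin n) → Fin (indicator b + c) → Fin (suc n)
  cons true  e zero    = zero
  cons true  e (suc a) = suc (e a)
  cons false e a       = suc (e a)

index : ∀ {n} (S : Subset n) → Fin n → Maybe (Fin (count S))
index {suc n} S = cons (S zero) (index (S ∘ suc))
  where
  cons : ∀ {c} (b : Bool) → (Fin n → Maybe (Fin c)) → Fin (suc n) → Maybe (Fin (indicator b + c))
  cons true  p zero    = just zero
  cons true  p (suc i) = Maybe.map suc (p i)
  cons false p zero    = nothing
  cons false p (suc i) = p i

enumerate-∈ : ∀ {n} (S : Subset n) a → S (enumerate S a) ≡ true
enumerate-∈ {suc n} S a with S zero in s0
enumerate-∈ {suc n} S zero    | true  = s0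
enumerate-∈ {suc n} S (suc a) | true  = enumerate-∈ (S ∘ suc) a
enumerate-∈ {suc n} S a       | false = enumerate-∈ (S ∘ suc) a

index-enumerate : ∀ {n} (S : Subset n) a → index S (enumerate S a) ≡ just a
index-enumerate {suc n} S a with S zero
index-enumerate {suc n} S zero    | true  = refl
index-enumerate {suc n} S (suc a) | true  = cong (Maybe.map suc) (index-enumerate (S ∘ suc) a)
index-enumerate {suc n} S a       | false = index-enumerate (S ∘ suc) a

enumerate-injective : ∀ {n} (S : Subset n) → Injective _≡_ _≡_ (enumerate S)
enumerate-injective S {a} {b} eq =
  just-injective (trans (sym (index-enumerate S a)) (trans (cong (index S) eq) (index-enumerate S b)))

index-∈ : ∀ {n} (S : Subset n) i → S i ≡ true → Σ (Fin (count S)) λ a → index S i ≡ just a × enumerate S a ≡ i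
index-∈ {suc n} S i si with S zero in s0
index-∈ {suc n} S zero    si | true  = zero , refl , refl
index-∈ {suc n} S (suc i) si | true  with index-∈ (S ∘ suc) i si
... | a , ia , ea = suc a , cong (Maybe.map suc) ia , cong suc ea
index-∈ {suc n} S zero    si | false with trans (sym s0) si
... | ()
index-∈ {suc n} S (suc i) si | false with index-∈ (S ∘ suc) i si
... | a , ia , ea = a , ia , cong suc ea

enumerate-<ᵇ : ∀ {n} (S : Subset n) a b → (toℕ (enumerate S a) <ᵇ toℕ (enumerate S b)) ≡ (toℕ a <ᵇ toℕ b)
enumerate-<ᵇ {suc n} S a b with S zero
enumerate-<ᵇ {suc n} S zero    zero    | true  = refl
enumerate-<ᵇ {suc n} S zero    (suc b) | true  = refl
enumerate-<ᵇ {suc n} S (suc a) zero    | true  = refl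
enumerate-<ᵇ {suc n} S (suc a) (suc b) | true  = enumerate-<ᵇ (S ∘ suc) a b
enumerate-<ᵇ {suc n} S a       b       | false = enumerate-<ᵇ (S ∘ suc) a b

∑-enumerate : ∀ {n} (S : Subset n) (h : Fin n → ℕ) →
  ∑[ a < count S ] h (enumerate S a) ≡ ∑[ i < n ] (if S i then h i else 0)
∑-enumerate {zero}  S h = refl
∑-enumerate {suc n} S h with S zero
... | true  = cong (h zero +_) (∑-enumerate (S ∘ suc) (h ∘ suc))
... | false = ∑-enumerate (S ∘ suc) (h ∘ suc)

pairCount-enumerate : ∀ {n} (S : Subset n) (A : Fin n → Fin n → Bool) →
  ∑[ a < count S ] ∑[ b < count S ] pairTerm A (enumerate S a) (enumerate S b)
    ≡ pairCount (λ i j → S i ∧ S j ∧ A i j)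
pairCount-enumerate {n} S A = begin
  ∑[ a < count S ] ∑[ b < count S ] pairTerm A (e a) (e b)
    ≡⟨ sum-cong-≗ (λ a → ∑-enumerate S (pairTerm A (e a))) ⟩
  ∑[ a < count S ] ∑[ j < n ] (if S j then pairTerm A (e a) j else 0)
    ≡⟨ ∑-enumerate S (λ i → ∑[ j < n ] (if S j then pairTerm A i j else 0)) ⟩
  ∑[ i < n ] (if S i then ∑[ j < n ] (if S j then pairTerm A i j else 0) else 0)
    ≡⟨ sum-cong-≗ row ⟩
  ∑[ i < n ] ∑[ j < n ] pairTerm (λ i j → S i ∧ S j ∧ A i j) i j
    ≡⟨ pairCount≡∑ (λ i j → S i ∧ S j ∧ A i j) ⟨
  pairCount (λ i j → S i ∧ S j ∧ A i j) ∎
  where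
  open ≡-Reasoning
  e = enumerate S
  row : ∀ i → (if S i then ∑[ j < n ] (if S j then pairTerm A i j else 0) else 0)
            ≡ ∑[ j < n ] pairTerm (λ i j → S i ∧ S j ∧ A i j) i j
  row i with S i
  ... | false = sym (sum-replicate-zero n)
  ... | true  = sum-cong-≗ entry
    where
    entry : ∀ j → (if S j then pairTerm A i j else 0) ≡ pairTerm (λ i j → true ∧ S j ∧ A i j) i j
    entry j with S j
    ... | true  = refl
    ... | false = refl

-- Replacing W by two vertices

module _ {n} (G : Graph n) (W : Subset n) where

  private
    k = count (∁ W)
    e = enumerate (∁ W)

  -- Vertices 0 and 1 are the new vertices; vertex 2 + a is the a-th vertex outside W.
  contractAdj : Fin (2 + k) → Fin (2 + k) → Bool
  contractAdj (suc (suc a)) (suc (suc b)) = adj G (e a) (e b)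
  contractAdj (suc (suc a)) _             = true
  contractAdj _             (suc (suc b)) = true
  contractAdj _             _             = false

  contractAdj-sym : ∀ p q → contractAdj p q ≡ contractAdj q p
  contractAdj-sym zero          zero          = refl
  contractAdj-sym zero          (suc zero)    = refl
  contractAdj-sym zero          (suc (suc b)) = refl
  contractAdj-sym (suc zero)    zero          = refl
  contractAdj-sym (suc zero)    (suc zero)    = refl
  contractAdj-sym (suc zero)    (suc (suc b)) = refl
  contractAdj-sym (suc (suc a)) zero          = refl
  contractAdj-sym (suc (suc a)) (suc zero)    = refl
  contractAdj-sym (suc (suc a)) (suc (suc b)) = Graph.sym G (e a) (e b)

  contractAdj-irrefl : ∀ p → contractAdj p p ≡ false
  contractAdj-irrefl zero          = refl
  contractAdj-irrefl (suc zero)    = refl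
  contractAdj-irrefl (suc (suc a)) = irrefl G (e a)

  contract : Graph (2 + k)
  contract = record { adj = contractAdj ; sym = contractAdj-sym ; irrefl = contractAdj-irrefl }

  size-complement-contract : size (complement contract) ≡ suc (inducedSize (complement G) (∁ W))
  size-complement-contract = begin
    size (complement contract)
      ≡⟨ pairCount≡∑ B′ ⟩
    -- the rows and columns of the new vertices unfold; only the pair {0, 1} contributes
    (0 + (1 + ∑[ j < k ] 0)) + ((0 + (0 + ∑[ j < k ] 0)) + ∑[ a < k ] ∑[ b < k ] pairTerm B′ (suc (suc a)) (suc (suc b)))
      ≡⟨ cong₂ _+_ (cong suc (sum-replicate-zero k)) (cong₂ _+_ (sum-replicate-zero k) (∑₂-cong k inner)) ⟩
    suc (∑[ a < k ] ∑[ b < k ] pairTerm (adj (complement G)) (e a) (e b))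
      ≡⟨ cong suc (pairCount-enumerate (∁ W) (adj (complement G))) ⟩
    suc (inducedSize (complement G) (∁ W)) ∎
    where
    open ≡-Reasoning
    B′ = adj (complement contract)
    inner : ∀ a b → pairTerm B′ (suc (suc a)) (suc (suc b)) ≡ pairTerm (adj (complement G)) (e a) (e b)
    inner a b rewrite ⌊≟⌋-injective {n = 2 + k} (λ c → suc (suc c)) (suc-injective ∘ suc-injective) a b
                    | ⌊≟⌋-injective e (enumerate-injective (∁ W)) a b
                    | enumerate-<ᵇ (∁ W) a b = refl

module Lift {n} (G : Graph n) (W : Subset n) (closed : Closed (complement G) W)
  (O : OrientationOn G W) (side : Fin n → Bool) (good : IsGoodVia O side)
  (representative : ∀ b → Σ (Fin n) λ x → W x ≡ true × side x ≡ b) where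

  private
    k = count (∁ W)
    e = enumerate (∁ W)

  hub : Bool → Fin (2 + k)
  hub true  = zero
  hub false = suc zero

  hub≢outer : ∀ b a → hub b ≢ suc (suc a)
  hub≢outer true  a ()
  hub≢outer false a ()

  hub-injective : ∀ b c → hub b ≡ hub c → b ≡ c
  hub-injective true  true  _ = refl
  hub-injective false false _ = refl

  hub-nonadjacent : ∀ b c → contractAdj G W (hub b) (hub c) ≡ false
  hub-nonadjacent true  true  = refl
  hub-nonadjacent true  false = refl
  hub-nonadjacent false true  = refl
  hub-nonadjacent false false = refl

  hub-adjacent : ∀ b a → contractAdj G W (hub b) (suc (suc a)) ≡ true
  hub-adjacent true  a = refl
  hub-adjacent false a = refl

  squash : Fin n → Fin (2 + k)
  squash x = go (W x) (index (∁ W) x)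
    where
    go : Bool → Maybe (Fin k) → Fin (2 + k)
    go true  _        = hub (side x)
    go false (just a) = suc (suc a)
    go false nothing  = zero   -- unreachable: index (∁ W) x is defined when W x ≡ false

  squash-in : ∀ x → W x ≡ true → squash x ≡ hub (side x)
  squash-in x wx rewrite wx = refl

  W∘enumerate : ∀ a → W (e a) ≡ false
  W∘enumerate a with W (e a) | enumerate-∈ (∁ W) a
  ... | false | _  = refl
  ... | true  | ()

  squash-enumerate : ∀ a → squash (e a) ≡ suc (suc a)
  squash-enumerate a rewrite W∘enumerate a | index-enumerate (∁ W) a = refl

  squash-out : ∀ x → W x ≡ false → Σ (Fin k) λ a → squash x ≡ suc (suc a) × e a ≡ x
  squash-out x wx with index-∈ (∁ W) x (cong not wx)
  ... | a , ix , ea rewrite wx | ix = a , refl , ea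

  cross : ∀ x y → W x ≡ true → W y ≡ false → adj G x y ≡ true
  cross = Closed-complement⇒adj G W closed

  membership : ∀ x → W x ≡ true ⊎ W x ≡ false
  membership x with W x
  ... | true  = inj₁ refl
  ... | false = inj₂ refl

  contractAdj-squash : ∀ x y → W x ∧ W y ≡ false → contractAdj G W (squash x) (squash y) ≡ adj G x y
  contractAdj-squash x y h with membership x | membership y
  ... | inj₁ wx | inj₁ wy with trans (sym (cong₂ _∧_ wx wy)) h
  ...   | ()
  contractAdj-squash x y h | inj₁ wx | inj₂ wy with squash-out y wy
  ... | b , sy , _ rewrite squash-in x wx | sy = trans (hub-adjacent (side x) b) (sym (cross x y wx wy))
  contractAdj-squash x y h | inj₂ wx | inj₁ wy with squash-out x wx
  ... | a , sx , _ rewrite squash-in y wy | sx =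
    trans (contractAdj-sym G W (suc (suc a)) (hub (side y)))
      (trans (hub-adjacent (side y) a) (trans (sym (cross y x wy wx)) (Graph.sym G y x)))
  contractAdj-squash x y h | inj₂ wx | inj₂ wy with squash-out x wx | squash-out y wy
  ... | a , sx , refl | b , sy , refl rewrite sx | sy = refl

  squash-injective : ∀ x y → W x ∧ W y ≡ false → squash x ≡ squash y → x ≡ y
  squash-injective x y h eq with membership x | membership y
  ... | inj₁ wx | inj₁ wy with trans (sym (cong₂ _∧_ wx wy)) h
  ...   | ()
  squash-injective x y h eq | inj₁ wx | inj₂ wy with squash-out y wy
  ... | b , sy , _ = ⊥-elim (hub≢outer (side x) b (trans (sym (squash-in x wx)) (trans eq sy)))
  squash-injective x y h eq | inj₂ wx | inj₁ wy with squash-out x wx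
  ... | a , sx , _ = ⊥-elim (hub≢outer (side y) a (trans (sym (squash-in y wy)) (trans (sym eq) sx)))
  squash-injective x y h eq | inj₂ wx | inj₂ wy with squash-out x wx | squash-out y wy
  ... | a , sx , ea | b , sy , eb with suc-injective (suc-injective (trans (sym sx) (trans eq sy)))
  ...   | refl = trans (sym ea) eb

  adj-hub⇒outside : ∀ x b → contractAdj G W (squash x) (hub b) ≡ true → W x ≡ false
  adj-hub⇒outside x b adj with membership x
  ... | inj₂ wx = wx
  ... | inj₁ wx rewrite squash-in x wx | hub-nonadjacent (side x) b with adj
  ...   | ()

  inside⊎outside : ∀ x y → (W x ≡ true × W y ≡ true) ⊎ W x ∧ W y ≡ false
  inside⊎outside x y with W x | W y
  ... | true  | true  = inj₁ (refl , refl)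
  ... | true  | false = inj₂ refl
  ... | false | _     = inj₂ refl

  outside-sym : ∀ x y → W x ∧ W y ≡ false → W y ∧ W x ≡ false
  outside-sym x y h = trans (∧-comm (W y) (W x)) h

  module _ (O′ : OrientationOn (contract G W) allV) where

    private
      A′ = arc O′

    liftedArc : Fin n → Fin n → Bool
    liftedArc x y = if W x ∧ W y then arc O x y else A′ (squash x) (squash y)

    liftedArc-inside : ∀ x y → W x ≡ true → W y ≡ true → liftedArc x y ≡ arc O x y
    liftedArc-inside x y wx wy rewrite wx | wy = refl

    liftedArc-outside : ∀ x y → W x ∧ W y ≡ false → liftedArc x y ≡ A′ (squash x) (squash y)
    liftedArc-outside x y h rewrite h = refl

    arc′⇒adj : ∀ p q → A′ p q ≡ true → contractAdj G W p q ≡ true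
    arc′⇒adj p q a = proj₂ (proj₂ (arc-inside O′ p q a))

    liftedOrientation : OrientationOn G allV
    liftedOrientation = record
      { arc = liftedArc ; arc-inside = inside ; arc-total = total ; arc-antisym = antisym }
      where
      inside : ∀ x y → liftedArc x y ≡ true → true ≡ true × true ≡ true × adj G x y ≡ true
      inside x y a with inside⊎outside x y
      ... | inj₁ (wx , wy) =
        refl , refl , proj₂ (proj₂ (arc-inside O x y (trans (sym (liftedArc-inside x y wx wy)) a)))
      ... | inj₂ h =
        refl , refl , trans (sym (contractAdj-squash x y h))
                            (arc′⇒adj _ _ (trans (sym (liftedArc-outside x y h)) a))
      total : ∀ x y → true ≡ true → true ≡ true → adj G x y ≡ true → liftedArc x y ≡ true ⊎ liftedArc y x ≡ true
      total x y _ _ gxy with inside⊎outside x y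
      ... | inj₁ (wx , wy) with arc-total O x y wx wy gxy
      ...   | inj₁ a = inj₁ (trans (liftedArc-inside x y wx wy) a)
      ...   | inj₂ a = inj₂ (trans (liftedArc-inside y x wy wx) a)
      total x y _ _ gxy | inj₂ h with arc-total O′ (squash x) (squash y) refl refl (trans (contractAdj-squash x y h) gxy)
      ...   | inj₁ a = inj₁ (trans (liftedArc-outside x y h) a)
      ...   | inj₂ a = inj₂ (trans (liftedArc-outside y x (outside-sym x y h)) a)
      antisym : ∀ x y → liftedArc x y ≡ true → liftedArc y x ≡ false
      antisym x y a with inside⊎outside x y
      ... | inj₁ (wx , wy) =
        trans (liftedArc-inside y x wy wx) (arc-antisym O x y (trans (sym (liftedArc-inside x y wx wy)) a))
      ... | inj₂ h =
        trans (liftedArc-outside y x (outside-sym x y h))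
              (arc-antisym O′ (squash x) (squash y) (trans (sym (liftedArc-outside x y h)) a))

    path₂-via-hub : ∀ x y b → A′ (squash x) (hub b) ≡ true → A′ (hub b) (squash y) ≡ true →
      Σ (Fin n) λ z → liftedArc x z ≡ true × liftedArc z y ≡ true
    path₂-via-hub x y b a₁ a₂ with representative b
    ... | z , wz , refl =
      z , trans (liftedArc-outside x z (cong (_∧ W z) wx)) (subst (λ p → A′ (squash x) p ≡ true) (sym sz) a₁)
        , trans (liftedArc-outside z y (trans (cong (W z ∧_) wy) (∧-zeroʳ (W z))))
                (subst (λ p → A′ p (squash y) ≡ true) (sym sz) a₂)
      where
      wx = adj-hub⇒outside x (side z) (arc′⇒adj _ _ a₁)
      wy = adj-hub⇒outside y (side z) (trans (contractAdj-sym G W (squash y) (hub (side z))) (arc′⇒adj _ _ a₂))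
      sz = squash-in z wz

    path₂ : ∀ x y m → A′ (squash x) m ≡ true → A′ m (squash y) ≡ true →
      Σ (Fin n) λ z → liftedArc x z ≡ true × liftedArc z y ≡ true
    path₂ x y zero          = path₂-via-hub x y true
    path₂ x y (suc zero)    = path₂-via-hub x y false
    path₂ x y (suc (suc c)) a₁ a₂ =
      e c , trans (liftedArc-outside x (e c) (trans (cong (W x ∧_) wc) (∧-zeroʳ (W x))))
                  (subst (λ p → A′ (squash x) p ≡ true) (sym sc) a₁)
          , trans (liftedArc-outside (e c) y (cong (_∧ W y) wc))
                  (subst (λ p → A′ p (squash y) ≡ true) (sym sc) a₂)
      where
      wc = W∘enumerate c
      sc = squash-enumerate c

    lift-dist≤2 : ∀ x y → (squash x ≡ squash y → x ≡ y) →
      (A′ (squash x) (squash y) ≡ true → liftedArc x y ≡ true) →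
      dist≤2 A′ (squash x) (squash y) → dist≤2 liftedArc x y
    lift-dist≤2 x y inj lift-arc (inj₁ eq)                 = inj₁ (inj eq)
    lift-dist≤2 x y inj lift-arc (inj₂ (inj₁ a))           = inj₂ (inj₁ (lift-arc a))
    lift-dist≤2 x y inj lift-arc (inj₂ (inj₂ (m , a₁ , a₂))) = inj₂ (inj₂ (path₂ x y m a₁ a₂))

    lift-good : ∀ x y → dist≤2 (arc O) x y → dist≤2 liftedArc x y
    lift-good x y (inj₁ eq) = inj₁ eq
    lift-good x y (inj₂ (inj₁ a)) with arc-inside O x y a
    ... | wx , wy , _ = inj₂ (inj₁ (trans (liftedArc-inside x y wx wy) a))
    lift-good x y (inj₂ (inj₂ (z , a₁ , a₂))) with arc-inside O x z a₁ | arc-inside O z y a₂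
    ... | wx , wz , _ | _ , wy , _ =
      inj₂ (inj₂ (z , trans (liftedArc-inside x z wx wz) a₁ , trans (liftedArc-inside z y wz wy) a₂))

    liftedOrientation-diam2 : (∀ p q → dist≤2 A′ p q) → ∀ x y → dist≤2 liftedArc x y
    liftedOrientation-diam2 d′ x y with inside⊎outside x y
    ... | inj₂ h = lift-dist≤2 x y (squash-injective x y h) (trans (liftedArc-outside x y h))
                     (d′ (squash x) (squash y))
    ... | inj₁ (wx , wy) with side x ≟ᵇ side y
    ...   | yes same = lift-good x y (good x y wx wy same)
    ...   | no differ = lift-dist≤2 x y
            (λ eq → ⊥-elim (differ (hub-injective _ _ (trans (sym (squash-in x wx)) (trans eq (squash-in y wy))))))
            (λ a → ⊥-elim (hub-arc (arc′⇒adj _ _ a)))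
            (d′ (squash x) (squash y))
      where
      hub-arc : contractAdj G W (squash x) (squash y) ≢ true
      hub-arc rewrite squash-in x wx | squash-in y wy | hub-nonadjacent (side x) (side y) = λ ()

  lift-diam2 : HasDiam2Orientation (contract G W) → HasDiam2Orientation G
  lift-diam2 (O′ , d′) = liftedOrientation O′ , liftedOrientation-diam2 O′ d′

module _ {n} {G : Graph n} {W : Subset n} (O : OrientationOn G W) (side : Fin n → Bool)
  (nonTrivial : IsNonTrivialVia O side) {w : Fin n} (w∈W : W w ≡ true) where

  nonTrivial⇒both-sides : ∀ b → Σ (Fin n) λ x → W x ≡ true × side x ≡ b
  nonTrivial⇒both-sides b with side w ≟ᵇ b | nonTrivial w w∈W
  ... | yes refl | _ = w , w∈W , refl
  ... | no  w≢b  | _ , (y , y∈W , y≢w , _) =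
    y , y∈W , trans (¬-not y≢w) (trans (cong not (¬-not w≢b)) (not-involutive b))

  nonTrivial⇒3≤card : 3 ≤ card W
  nonTrivial⇒3≤card with nonTrivial w w∈W
  ... | (z , z∈W , z≢w , z→w) , (y , y∈W , y≢w , w→y) =
    three-members⇒3≤card W w y z w∈W y∈W z∈W (λ { refl → y≢w refl }) (λ { refl → z≢w refl }) y≢z
    where
    y≢z : y ≢ z
    y≢z refl with trans (sym (arc-antisym O w y w→y)) z→w
    ... | ()

contract-complementBound : ∀ {n} (G : Graph n) (W : Subset n) → Closed (complement G) W →
  -1ℤ ≤ℤ excessInduced (complement G) W → size (complement G) + 5 ≤ n →
  size (complement (contract G W)) + 5 ≤ 2 + count (∁ W)
contract-complementBound {n} G W closed excess bound = begin
  size (complement (contract G W)) + 5 ≡⟨ cong (_+ 5) (size-complement-contract G W) ⟩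
  suc (c + 5)                          ≤⟨ s≤s (+-cancelˡ-≤ a _ _ a+c+5≤a+1+k) ⟩
  2 + k                                ∎
  where
  open ≤-Reasoning
  B = complement G
  a = inducedSize B W
  c = inducedSize B (∁ W)
  k = count (∁ W)
  a+c+5≤a+1+k : a + (c + 5) ≤ a + suc k
  a+c+5≤a+1+k = begin
    a + (c + 5) ≡⟨ +-assoc a c 5 ⟨
    a + c + 5   ≡⟨ cong (_+ 5) (inducedSize+inducedSize∁ B W closed) ⟩
    size B + 5  ≤⟨ bound ⟩
    n           ≡⟨ card+count∁≡n W ⟨
    card W + k  ≤⟨ +-monoˡ-≤ k (excess≥-1⇒card≤size+1 B W excess) ⟩
    suc a + k   ≡⟨ +-suc a k ⟨
    a + suc k   ∎

contract-isCounterexample : ∀ {n} (G : Graph n) (W : Subset n) →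
  IsCounterexample G → IsReduction G W → IsCounterexample (contract G W)
contract-isCounterexample G W (_ , edges , noDiam2) (((w , w∈W) , closed) , (O , side , good , nonTrivial) , excess) =
  m+n≤o⇒n≤o (size (complement (contract G W))) bound , complementBound⇒edgeBound (contract G W) bound ,
  noDiam2 ∘ Lift.lift-diam2 G W closed O side good (nonTrivial⇒both-sides O side nonTrivial w∈W)
  where
  bound = contract-complementBound G W closed excess (edgeBound⇒complementBound G edges)

contract-order< : ∀ {n} (G : Graph n) (W : Subset n) → IsReduction G W → 2 + count (∁ W) < n
contract-order< {n} G W (((w , w∈W) , _) , (O , side , _ , nonTrivial) , _) =
  subst (3 + count (∁ W) ≤_) (card+count∁≡n W) (+-monoˡ-≤ (count (∁ W)) (nonTrivial⇒3≤card O side nonTrivial w∈W))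

lemma5 : ∀ (n : ℕ) (G : Graph n) → IsMinimalCounterexample G →
    ¬ Σ (Subset n) (λ W → IsReduction G W)
lemma5 n G (counterexample , minimal) (W , reduction)
  with minimal _ (contract G W) (contract-isCounterexample G W counterexample reduction)
... | inj₁ n<n′       = <-asym n<n′ (contract-order< G W reduction)
... | inj₂ (n≡n′ , _) = <⇒≢ (contract-order< G W reduction) (sym n≡n′)
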